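{- Let $D$ be a connected digraph with at least $3$ vertices. The following are equivalent: (i) $\langle D\rangle$ is a band; (ii) $\langle D\rangle$ is completely regular; (iii) $D$ is directed-bipartite.
   Context: For $a\neq b$ in $\{1,\ldots,n\}$, $(a\to b)$ denotes the transformation mapping $a$ to $b$ and fixing every other point; transformations are composed left to right. For a digraph $D$ on $\{1,\ldots,n\}$ (no loops, no multiple arcs), $\langle D\rangle$ is the semigroup generated by all $(a\to b)$ with $(a,b)$ an arc. A digraph is connected if its underlying undirected graph is connected. A band is a semigroup in which every element is idempotent; a semigroup is completely regular if every element lies in a subgroup. $D$ is directed-bipartite if its vertex set can be partitioned into $V_1,V_2$ such that every arc $(a,b)$ has $a\in V_1$ and $b\in V_2$. -}

module Defs where

open import Data.Nat using (ℕ; _≤_)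
open import Data.Fin using (Fin; _≟_)
open import Data.Bool using (Bool; true; false)
open import Data.Product using (Σ; ∃; _×_; _,_)
open import Relation.Nullary using (¬_; yes; no)
open import Relation.Binary.PropositionalEquality using (_≡_)
open import Relation.Binary.Construct.Closure.ReflexiveTransitive using (Star)
open import Relation.Binary.Construct.Closure.Symmetric using (SymClosure)

-- A digraph on vertex set {1..n} (represented as Fin n): an arc relation
-- without loops. (A relation has no multiple arcs by construction.)
record Digraph (n : ℕ) : Set₁ where
  field
    Arc   : Fin n → Fin n → Set
    loopless : ∀ a → ¬ Arc a a
open Digraph public

Trans : ℕ → Set
Trans n = Fin n → Fin n

_≈_ : ∀ {n} → Trans n → Trans n → Set
f ≈ g = ∀ x → f x ≡ g x

-- composition, left to right: (f · g) first applies f, then g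
_·_ : ∀ {n} → Trans n → Trans n → Trans n
(f · g) x = g (f x)

[_↦_] : ∀ {n} → Fin n → Fin n → Trans n
[ a ↦ b ] x with x ≟ a
... | yes _ = b
... | no _  = x

data ⟨_⟩∋_ {n : ℕ} (D : Digraph n) : Trans n → Set where
  gen : ∀ {a b} → Arc D a b → ⟨ D ⟩∋ [ a ↦ b ]
  mul : ∀ {f g} → ⟨ D ⟩∋ f → ⟨ D ⟩∋ g → ⟨ D ⟩∋ (f · g)
  resp : ∀ {f g} → f ≈ g → ⟨ D ⟩∋ f → ⟨ D ⟩∋ g

IsBand : ∀ {n} → Digraph n → Set
IsBand D = ∀ f → ⟨ D ⟩∋ f → (f · f) ≈ f

IsSubgroup : ∀ {n} → Digraph n → (Trans n → Set) → Set
IsSubgroup {n} D H =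
    (∀ f → H f → ⟨ D ⟩∋ f)
  × (∀ f g → H f → H g → H (f · g))
  × Σ (Trans n) λ e → H e
      × (∀ f → H f → ((e · f) ≈ f) × ((f · e) ≈ f))
      × (∀ f → H f → Σ (Trans n) λ g → H g × ((f · g) ≈ e) × ((g · f) ≈ e))

IsCompletelyRegular : ∀ {n} → Digraph n → Set₁
IsCompletelyRegular {n} D =
  ∀ f → ⟨ D ⟩∋ f → Σ (Trans n → Set) λ H → IsSubgroup D H × H f

Connected : ∀ {n} → Digraph n → Set
Connected D = ∀ a b → Star (SymClosure (Arc D)) a b

DirectedBipartite : ∀ {n} → Digraph n → Set
DirectedBipartite {n} D =
  Σ (Fin n → Bool) λ inV₁ → ∀ a b → Arc D a b → (inV₁ a ≡ true) × (inV₁ b ≡ false)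

module Submission where

-- Call a transformation f "square-cancelling" if f (f x) ≡ f (f y)
-- forces f x ≡ f y.  Idempotents and elements of subgroups are square-cancelling.
-- An "open two-path" c → a → b with c ≢ b yields the element
-- (a → b)(c → a) of ⟨D⟩, which sends c ↦ a, a ↦ b, b ↦ b and so is not
-- square-cancelling.  Hence if ⟨D⟩ is a band or completely regular, D has no
-- open two-path.  For connected D on at least 3 vertices this forbids closed
-- two-paths c → a → c as well (a third vertex is reached along a path that
-- must leave {a, c} through an arc creating an open two-path), so no vertex
-- is both head and tail of an arc, and colouring every vertex by one incident
-- arc is a directed bipartition.  Conversely, for a directed bipartition
-- V₁ ⊎ V₂ every element of ⟨D⟩ fixes V₂ pointwise and moves points only into
-- V₂; such maps are idempotent, so ⟨D⟩ is a band, and a band is completely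
-- regular since each idempotent f forms the trivial subgroup {f}.

open import Defs
open import Data.Nat using (ℕ; _≤_; s≤s)
open import Data.Fin using (Fin; zero; suc; _≟_)
open import Data.Bool using (Bool; true; false)
open import Data.Product using (_×_; Σ; ∃; _,_; proj₁; proj₂)
open import Data.Sum using (_⊎_; inj₁; inj₂; [_,_])
open import Data.Empty using (⊥; ⊥-elim)
open import Function.Bundles using (_⇔_; mk⇔)
open import Relation.Nullary using (¬_; yes; no; Dec)
open import Relation.Nullary.Decidable using (_⊎-dec_)
open import Relation.Binary.PropositionalEquality
  using (_≡_; _≢_; refl; sym; trans; cong; module ≡-Reasoning)
open import Relation.Binary.Construct.Closure.ReflexiveTransitive using (Star; ε; _◅_)
open import Relation.Binary.Construct.Closure.Symmetric using (SymClosure; fwd; bwd)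

↦-hit : ∀ {n} (a b : Fin n) → [ a ↦ b ] a ≡ b
↦-hit a b with a ≟ a
... | yes _  = refl
... | no a≢a = ⊥-elim (a≢a refl)

↦-miss : ∀ {n} (a b : Fin n) {x : Fin n} → x ≢ a → [ a ↦ b ] x ≡ x
↦-miss a b {x} x≢a with x ≟ a
... | yes x≡a = ⊥-elim (x≢a x≡a)
... | no _    = refl

avoidTwo : ∀ {n} → 3 ≤ n → (a b : Fin n) → ∃ λ x → x ≢ a × x ≢ b
avoidTwo (s≤s (s≤s (s≤s _))) = avoid
  where
  avoid : ∀ {m} (a b : Fin (ℕ.suc (ℕ.suc (ℕ.suc m)))) → ∃ λ x → x ≢ a × x ≢ b
  avoid zero          zero          = suc zero , (λ ()) , (λ ())
  avoid zero          (suc zero)    = suc (suc zero) , (λ ()) , (λ ())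
  avoid zero          (suc (suc _)) = suc zero , (λ ()) , (λ ())
  avoid (suc zero)    zero          = suc (suc zero) , (λ ()) , (λ ())
  avoid (suc (suc _)) zero          = suc zero , (λ ()) , (λ ())
  avoid (suc _)       (suc _)       = zero , (λ ()) , (λ ())

crossingEdge : ∀ {A : Set} (R : A → A → Set) (S : A → Set) → (∀ x → Dec (S x)) →
  ∀ {u x} → Star R u x → S u → ¬ S x → ∃ λ u′ → ∃ λ v → S u′ × ¬ S v × R u′ v
crossingEdge R S S? ε              Su ¬Sx = ⊥-elim (¬Sx Su)
crossingEdge R S S? {u} (_◅_ {j = w} r rest) Su ¬Sx with S? w
... | yes Sw = crossingEdge R S S? rest Sw ¬Sx
... | no ¬Sw = u , w , Su , ¬Sw , r

SquareCancelling : ∀ {n} → Trans n → Set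
SquareCancelling f = ∀ x y → f (f x) ≡ f (f y) → f x ≡ f y

idempotent⇒squareCancelling : ∀ {n} {f : Trans n} → (f · f) ≈ f → SquareCancelling f
idempotent⇒squareCancelling idem x y ffx≡ffy =
  trans (sym (idem x)) (trans ffx≡ffy (idem y))

-- Elements of a subgroup are square-cancelling: with identity e and inverse g
-- of f, every f z equals g (f (f z)).
subgroup⇒squareCancelling : ∀ {n} {D : Digraph n} {H : Trans n → Set} {f : Trans n} →
  IsSubgroup D H → H f → SquareCancelling f
subgroup⇒squareCancelling {f = f} (_ , _ , _ , _ , identity , inverse) Hf x y ffx≡ffy
  with inverse f Hf
... | g , _ , f·g≈e , _ = begin
    f x           ≡⟨ recover x ⟩
    g (f (f x))   ≡⟨ cong g ffx≡ffy ⟩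
    g (f (f y))   ≡⟨ sym (recover y) ⟩
    f y           ∎
  where
  open ≡-Reasoning
  recover : ∀ z → f z ≡ g (f (f z))
  recover z = trans (sym (proj₂ (identity f Hf) z)) (sym (f·g≈e (f z)))

completelyRegular⇒squareCancelling : ∀ {n} (D : Digraph n) → IsCompletelyRegular D →
  ∀ f → ⟨ D ⟩∋ f → SquareCancelling f
completelyRegular⇒squareCancelling D cr f mf with cr f mf
... | _ , subgroup , Hf = subgroup⇒squareCancelling subgroup Hf

-- For distinct a, b, c the product (a → b)(c → a) maps c ↦ a, a ↦ b, b ↦ b,
-- so it identifies the squares of c and a but not their images.
twoStep-notSquareCancelling : ∀ {n} {a b c : Fin n} → a ≢ b → c ≢ a → c ≢ b →
  ¬ SquareCancelling ([ a ↦ b ] · [ c ↦ a ])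
twoStep-notSquareCancelling {a = a} {b} {c} a≢b c≢a c≢b cancels =
  a≢b (begin
    a     ≡⟨ sym hc ⟩
    h c   ≡⟨ cancels c a (trans hhc (sym hha)) ⟩
    h a   ≡⟨ ha ⟩
    b     ∎)
  where
  open ≡-Reasoning
  h : Trans _
  h = [ a ↦ b ] · [ c ↦ a ]
  b≢c : b ≢ c
  b≢c b≡c = c≢b (sym b≡c)
  hc : h c ≡ a
  hc = trans (cong [ c ↦ a ] (↦-miss a b c≢a)) (↦-hit c a)
  ha : h a ≡ b
  ha = trans (cong [ c ↦ a ] (↦-hit a b)) (↦-miss c a b≢c)
  hb : h b ≡ b
  hb = trans (cong [ c ↦ a ] (↦-miss a b (λ b≡a → a≢b (sym b≡a)))) (↦-miss c a b≢c)
  hhc : h (h c) ≡ b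
  hhc = trans (cong h hc) ha
  hha : h (h a) ≡ b
  hha = trans (cong h ha) hb

arc⇒distinct : ∀ {n} (D : Digraph n) {a b} → Arc D a b → a ≢ b
arc⇒distinct D {a} ab refl = loopless D a ab

NoOpenTwoPath : ∀ {n} → Digraph n → Set
NoOpenTwoPath D = ∀ {c a b} → Arc D c a → Arc D a b → c ≢ b → ⊥

squareCancelling⇒noOpenTwoPath : ∀ {n} (D : Digraph n) →
  (∀ f → ⟨ D ⟩∋ f → SquareCancelling f) → NoOpenTwoPath D
squareCancelling⇒noOpenTwoPath D cancelling ca ab c≢b =
  twoStep-notSquareCancelling (arc⇒distinct D ab) (arc⇒distinct D ca) c≢b
    (cancelling _ (mul (gen ab) (gen ca)))

module WithoutOpenTwoPaths {n} (D : Digraph n) (n≥3 : 3 ≤ n) (conn : Connected D)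
                           (noOpen : NoOpenTwoPath D) where

  incidentArc : ∀ a → (∃ λ b → Arc D a b) ⊎ (∃ λ c → Arc D c a)
  incidentArc a with avoidTwo n≥3 a a
  ... | x , x≢a , _ with crossingEdge (SymClosure (Arc D)) (_≡ a) (_≟ a) (conn a x) refl x≢a
  ...   | _ , b , refl , _ , fwd ab = inj₁ (b , ab)
  ...   | _ , c , refl , _ , bwd ca = inj₂ (c , ca)

  -- There is no closed two-path c → a → c either: a path from a to a third
  -- vertex leaves {a, c} along an arc that extends c → a → c to an open one.
  noClosedTwoPath : ∀ {a c} → Arc D c a → Arc D a c → ⊥
  noClosedTwoPath {a} {c} ca ac with avoidTwo n≥3 a c
  ... | x , x≢a , x≢c
    with crossingEdge (SymClosure (Arc D)) (λ y → y ≡ a ⊎ y ≡ c) (λ y → (y ≟ a) ⊎-dec (y ≟ c))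
                      (conn a x) (inj₁ refl) [ x≢a , x≢c ]
  ... | _ , v , inj₁ refl , v∉ , fwd av = noOpen ca av (λ c≡v → v∉ (inj₂ (sym c≡v)))
  ... | _ , v , inj₁ refl , v∉ , bwd va = noOpen va ac (λ v≡c → v∉ (inj₂ v≡c))
  ... | _ , v , inj₂ refl , v∉ , fwd cv = noOpen ac cv (λ a≡v → v∉ (inj₁ (sym a≡v)))
  ... | _ , v , inj₂ refl , v∉ , bwd vc = noOpen vc ca (λ v≡a → v∉ (inj₁ v≡a))

  noTwoPath : ∀ {c a b} → Arc D c a → Arc D a b → ⊥
  noTwoPath {c} {a} {b} ca ab with c ≟ b
  ... | yes refl = noClosedTwoPath ca ab
  ... | no c≢b   = noOpen ca ab c≢b

  isTail : Fin n → Bool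
  isTail a with incidentArc a
  ... | inj₁ _ = true
  ... | inj₂ _ = false

  isTail-tail : ∀ {a b} → Arc D a b → isTail a ≡ true
  isTail-tail {a} ab with incidentArc a
  ... | inj₁ _       = refl
  ... | inj₂ (_ , ca) = ⊥-elim (noTwoPath ca ab)

  isTail-head : ∀ {a b} → Arc D a b → isTail b ≡ false
  isTail-head {b = b} ab with incidentArc b
  ... | inj₁ (_ , bd) = ⊥-elim (noTwoPath ab bd)
  ... | inj₂ _       = refl

  bipartite : DirectedBipartite D
  bipartite = isTail , λ _ _ ab → isTail-tail ab , isTail-head ab

Settles : ∀ {n} → (Fin n → Bool) → Trans n → Set
Settles col f = (∀ x → f x ≡ x ⊎ col (f x) ≡ false) × (∀ y → col y ≡ false → f y ≡ y)

settles⇒idempotent : ∀ {n} {col : Fin n → Bool} {f : Trans n} → Settles col f → (f · f) ≈ f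
settles⇒idempotent {f = f} (moves , fixes) x with moves x
... | inj₁ fx≡x   = cong f fx≡x
... | inj₂ col≡false = fixes (f x) col≡false

bipartite⇒settles : ∀ {n} {D : Digraph n} ((col , arcs) : DirectedBipartite D) →
  ∀ {f} → ⟨ D ⟩∋ f → Settles col f
bipartite⇒settles (col , arcs) (gen {a} {b} ab) = moves , fixes
  where
  moves : ∀ x → [ a ↦ b ] x ≡ x ⊎ col ([ a ↦ b ] x) ≡ false
  moves x with x ≟ a
  ... | yes _ = inj₂ (proj₂ (arcs a b ab))
  ... | no _  = inj₁ refl
  fixes : ∀ y → col y ≡ false → [ a ↦ b ] y ≡ y
  fixes y coly with y ≟ a
  ... | yes refl with () ← trans (sym coly) (proj₁ (arcs a b ab))
  ... | no _ = refl
bipartite⇒settles bip (mul {f} {g} mf mg) = moves , fixes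
  where
  col = proj₁ bip
  F = bipartite⇒settles bip mf
  G = bipartite⇒settles bip mg
  moves : ∀ x → g (f x) ≡ x ⊎ col (g (f x)) ≡ false
  moves x with proj₁ F x | proj₁ G x
  ... | inj₂ colfx | _       = inj₂ (trans (cong col (proj₂ G (f x) colfx)) colfx)
  ... | inj₁ fx≡x | inj₁ gx≡x = inj₁ (trans (cong g fx≡x) gx≡x)
  ... | inj₁ fx≡x | inj₂ colgx = inj₂ (trans (cong (λ z → col (g z)) fx≡x) colgx)
  fixes : ∀ y → col y ≡ false → g (f y) ≡ y
  fixes y coly = trans (cong g (proj₂ F y coly)) (proj₂ G y coly)
bipartite⇒settles bip (resp {f} {g} f≈g mf) = moves , fixes
  where
  col = proj₁ bip
  F = bipartite⇒settles bip mf
  moves : ∀ x → g x ≡ x ⊎ col (g x) ≡ false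
  moves x with proj₁ F x
  ... | inj₁ fx≡x  = inj₁ (trans (sym (f≈g x)) fx≡x)
  ... | inj₂ colfx = inj₂ (trans (cong col (sym (f≈g x))) colfx)
  fixes : ∀ y → col y ≡ false → g y ≡ y
  fixes y coly = trans (sym (f≈g y)) (proj₂ F y coly)

bipartite⇒band : ∀ {n} (D : Digraph n) → DirectedBipartite D → IsBand D
bipartite⇒band D bip f mf = settles⇒idempotent (bipartite⇒settles bip mf)

idempotent⇒subgroup : ∀ {n} {D : Digraph n} {f : Trans n} → ⟨ D ⟩∋ f → (f · f) ≈ f →
  IsSubgroup D (_≈ f)
idempotent⇒subgroup {f = f} mf idem =
  (λ g g≈f → resp (λ x → sym (g≈f x)) mf) , product , f , (λ _ → refl) , identity , inverse
  where
  product : ∀ g h → g ≈ f → h ≈ f → (g · h) ≈ f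
  product g h g≈f h≈f x = trans (h≈f (g x)) (trans (cong f (g≈f x)) (idem x))
  identity : ∀ g → g ≈ f → ((f · g) ≈ g) × ((g · f) ≈ g)
  identity g g≈f = (λ x → trans (product f g (λ _ → refl) g≈f x) (sym (g≈f x)))
                 , (λ x → trans (product g f g≈f (λ _ → refl) x) (sym (g≈f x)))
  inverse : ∀ g → g ≈ f → Σ (Trans _) λ k → k ≈ f × ((g · k) ≈ f) × ((k · g) ≈ f)
  inverse g g≈f = f , (λ _ → refl) , product g f g≈f (λ _ → refl) , product f g (λ _ → refl) g≈f

band⇒completelyRegular : ∀ {n} (D : Digraph n) → IsBand D → IsCompletelyRegular D
band⇒completelyRegular D band f mf = (_≈ f) , idempotent⇒subgroup mf (band f mf) , (λ _ → refl)

proposition5p1 : ∀ (n : ℕ) (D : Digraph n) → 3 ≤ n → Connected D →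
    (IsBand D ⇔ DirectedBipartite D) × (IsCompletelyRegular D ⇔ DirectedBipartite D)
proposition5p1 n D n≥3 conn =
    mk⇔ (λ band → bipartiteFrom (λ f mf → idempotent⇒squareCancelling (band f mf)))
        (bipartite⇒band D)
  , mk⇔ (λ cr → bipartiteFrom (completelyRegular⇒squareCancelling D cr))
        (λ bip → band⇒completelyRegular D (bipartite⇒band D bip))
  where
  bipartiteFrom : (∀ f → ⟨ D ⟩∋ f → SquareCancelling f) → DirectedBipartite D
  bipartiteFrom cancelling = WithoutOpenTwoPaths.bipartite D n≥3 conn
                               (squareCancelling⇒noOpenTwoPath D cancelling)
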